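{- Let $(G,\pi)$ be a parity game, $\tau$ a strategy for Odd, $T$ an $(n,d/2)$-universal tree with $h=d/2$, $\mathcal{C}$ a cover of $\mathcal{T}$, $w\in B(G_\tau)$, $j=\pi(w)/2$ and $0\le k<|\mathcal{C}_j|$. For every node $u\in V(J_w)$ and indices $0\le i\le i'<|\mathcal{C}^k_j|$: if $\lambda^k_{i,w}(u)\ne\top$, then $\lambda^k_{i',w}(u)\ne\top$.
   Context: A parity game: finite directed graph $G=(V,E)$, every node with an outgoing arc, $V=V_0\sqcup V_1$, priorities $\pi:V\to\{1,\dots,d\}$, $d$ even. A strategy for Odd is $\tau:V_1\to V$ with $v\tau(v)\in E$; $G_\tau=(V,E_\tau)$ with $E_\tau=\{vw\in E:v\in V_0\}\cup\{v\tau(v):v\in V_1\}$. For a subgraph $H$: $\pi(H)$ max priority, $H$ even if $\pi(H)$ even, $\Pi(H)$ nodes of priority $\pi(H)$, $H_p$ induced subgraph on nodes of priority $\le p$. Ordered trees: prefix-closed sets of tuples over a linearly ordered set, viewed as rooted trees, ordered lexicographically; leaves of a height-$h$ tree are at depth $h$, written $\xi=(\xi_{2h-1},\dots,\xi_1)$; $\xi|_p$ deletes components with index $<p$; $L(T)$ leaves, $\bar L(T)=L(T)\cup\{\top\}$, $\top$ maximal, $\top|_p=\top$. $T\sqsubseteq T'$: injective edge-preserving order-preserving leaf-to-leaf map; $\equiv$ both ways; $\sqsubset$ strict. $(\ell,h)$-universal: height $h$, every height-$h$ tree with $\le\ell$ leaves at depth $h$ embeds. For a labeling $\nu$ into $\bar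 L(S)$: arc $vw$ non-violated if ($\pi(v)$ even and $\nu(v)|_{\pi(v)}\ge\nu(w)|_{\pi(v)}$) or ($\pi(v)$ odd and ($\nu(v)|_{\pi(v)}>\nu(w)|_{\pi(v)}$ or $\nu(v)=\nu(w)=\top$)); violated otherwise; tight if $\nu(v)$ is the smallest element of $\bar L(S)$ making $vw$ non-violated when substituted for $\nu(v)$; loose if neither. Base nodes $B(G_\tau)$: nodes in $\Pi(C)$ for some even cycle $C$ of $G_\tau$. Covers: $\mathcal{T}_j$ = pairwise non-equivalent subtrees of $T$ rooted at depth $h-j$; cover $\mathcal{C}=(\mathcal{C}_0,\dots,\mathcal{C}_h)$, $\mathcal{C}_j=(\mathcal{C}^0_j,\dots)$ chains of $(\mathcal{T}_j,\sqsubseteq)$ covering $\mathcal{T}_j$; chain $\mathcal{C}^k_j$: $T^k_{0,j}\sqsubset T^k_{1,j}\sqsubset\cdots$. For $w\in B(G_\tau)$: $K_w$ is the strongly connected component of $w$ in $(G_\tau)_{\pi(w)}$; $K'_w$ is $K_w$ with all incoming arcs of nodes in $\Pi(K_w)\setminus\{w\}$ removed; $J_w$ is the subgraph of $K'_w$ induced by nodes that can reach $w$ in $K'_w$. For $0\le i<|\mathcal{C}^k_j|$, let $\nu_0:V(J_w)\to\bar L(T^k_{i,j})$ with $\nu_0(w)=\min L(T^k_{i,j})$, $\nu_0(u)=\top$ otherwise; $\lambda^k_{i,w}$ is the pointwise greatest labeling $\lambda\le\nu_0$ into $\bar L(T^k_{i,j})$ such that no arc of $J_w$ is loose w.r.t.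 $\lambda$. -}

module Defs where

open import Data.Nat using (ℕ; zero; suc; _+_; _≤_; _<_; _∸_)
open import Data.Bool using (Bool; true; false)
open import Data.Fin using (Fin; zero; suc; inject₁; fromℕ)
open import Data.List using (List; []; _∷_; _++_; [_]; length; take)
open import Data.List.Membership.Propositional using (_∈_)
open import Data.List.Relation.Unary.All using (All)
open import Data.List.Relation.Unary.Any using (Any)
open import Data.List.Relation.Unary.AllPairs using (AllPairs)
open import Data.List.Relation.Unary.Linked using (Linked)
open import Data.List.Relation.Unary.Unique.Propositional using (Unique)
open import Data.Maybe using (Maybe; just; nothing)
open import Data.Product using (Σ; ∃; ∃-syntax; _×_; _,_)
open import Data.Sum using (_⊎_)
open import Function.Definitions using (Injective)
open import Relation.Binary.PropositionalEquality using (_≡_; _≢_)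
open import Relation.Binary.Construct.Closure.ReflexiveTransitive using (Star)
open import Relation.Nullary using (¬_)

Even : ℕ → Set
Even p = ∃[ k ] p ≡ k + k

Odd : ℕ → Set
Odd p = ∃[ k ] p ≡ suc (k + k)

-- Parity games.  V = Fin N; the owner decides V₀ (Even) / V₁ (Odd).

data Player : Set where
  Even-player Odd-player : Player

record Game : Set where
  field
    N      : ℕ
    E      : Fin N → Fin N → Bool
    owner  : Fin N → Player
    d      : ℕ
    π      : Fin N → ℕ
    d-even : Even d
    π-range : ∀ v → 1 ≤ π v × π v ≤ d
    total  : ∀ v → ∃[ w ] E v w ≡ true

module _ (G : Game) where
  open Game G

  Arc : Fin N → Fin N → Set
  Arc v w = E v w ≡ true

  -- τ : V₁ → V, encoded as a total function whose values on V₀ are irrelevant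
  IsOddStrategy : (Fin N → Fin N) → Set
  IsOddStrategy τ = ∀ v → owner v ≡ Odd-player → Arc v (τ v)

  module _ (τ : Fin N → Fin N) where

    Eτ : Fin N → Fin N → Set
    Eτ v w = Arc v w × (owner v ≡ Even-player ⊎ (owner v ≡ Odd-player × w ≡ τ v))

    Sub : ℕ → Fin N → Fin N → Set
    Sub p v w = Eτ v w × π v ≤ p × π w ≤ p

    -- w ∈ B(G_τ): w ∈ Π(C) for some even (simple) cycle C of G_τ.
    -- A cycle is an injective c : Fin (suc m) → V with arcs c i → c (i+1), c m → c 0.
    IsBase : Fin N → Set
    IsBase w =
      ∃[ m ] Σ (Fin (suc m) → Fin N) λ c →
        Injective _≡_ _≡_ c
        × (∀ (i : Fin m) → Eτ (c (inject₁ i)) (c (suc i)))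
        × Eτ (c (fromℕ m)) (c zero)
        × (∃[ i ] c i ≡ w)
        × (∀ i → π (c i) ≤ π w)
        × Even (π w)

    InK : Fin N → Fin N → Set
    InK w u = π u ≤ π w × Star (Sub (π w)) u w × Star (Sub (π w)) w u

    KArc : Fin N → Fin N → Fin N → Set
    KArc w u x = InK w u × InK w x × Sub (π w) u x

    -- K'_w : remove incoming arcs of nodes of Π(K_w) ∖ {w}; note π(K_w) = π w
    K'Arc : Fin N → Fin N → Fin N → Set
    K'Arc w u x = KArc w u x × ¬ (π x ≡ π w × x ≢ w)

    InJ : Fin N → Fin N → Set
    InJ w u = InK w u × Star (K'Arc w) u w

    JArc : Fin N → Fin N → Fin N → Set
    JArc w u x = InJ w u × InJ w x × K'Arc w u x

-- Nodes are tuples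
-- (lists, root first).  A tree of height h all of whose leaves lie at
-- depth h is determined by its (finite, duplicate-free, nonempty) set of
-- leaves; its nodes are the prefixes of leaves.

record OTree (h : ℕ) : Set where
  field
    leaves   : List (List ℕ)
    nonempty : leaves ≢ []
    depth    : All (λ x → length x ≡ h) leaves
    distinct : Unique leaves
open OTree public

Node : ∀ {h} → OTree h → List ℕ → Set
Node T x = ∃[ z ] (x ++ z) ∈ leaves T

data _<ₗ_ : List ℕ → List ℕ → Set where
  []<∷  : ∀ {b y} → [] <ₗ (b ∷ y)
  head< : ∀ {a b x y} → a < b → (a ∷ x) <ₗ (b ∷ y)
  tail< : ∀ {a x y} → x <ₗ y → (a ∷ x) <ₗ (a ∷ y)

_≤ₗ_ : List ℕ → List ℕ → Set
x ≤ₗ y = x ≡ y ⊎ x <ₗ y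

_⊑_ : ∀ {h h'} → OTree h → OTree h' → Set
T ⊑ T' = Σ (List ℕ → List ℕ) λ f →
    (∀ x → Node T x → Node T' (f x))
  × (∀ x y → Node T x → Node T y → f x ≡ f y → x ≡ y)
  × (∀ x a → Node T (x ++ [ a ]) → ∃[ b ] f (x ++ [ a ]) ≡ f x ++ [ b ])
  × (∀ x y → Node T x → Node T y → x <ₗ y → f x <ₗ f y)
  × (∀ x → x ∈ leaves T → f x ∈ leaves T')

_≅_ : ∀ {h h'} → OTree h → OTree h' → Set
T ≅ T' = T ⊑ T' × T' ⊑ T

_⊏_ : ∀ {h h'} → OTree h → OTree h' → Set
T ⊏ T' = T ⊑ T' × ¬ (T' ⊑ T)

Universal : ℕ → (h : ℕ) → OTree h → Set
Universal ℓ h T = ∀ (S : OTree h) → length (leaves S) ≤ ℓ → S ⊑ T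

SubtreeAt : ∀ {h j} → OTree h → List ℕ → OTree j → Set
SubtreeAt T x S = ∀ z → (z ∈ leaves S → (x ++ z) ∈ leaves T)
                      × ((x ++ z) ∈ leaves T → z ∈ leaves S)

RootedAtDepth : ∀ {h j} → OTree h → ℕ → OTree j → Set
RootedAtDepth {h} {j} T δ S = ∃[ x ] length x ≡ δ × Node T x × SubtreeAt T x S

Reps : ∀ {h} → OTree h → (j : ℕ) → List (OTree j) → Set
Reps {h} T j 𝒯j =
    All (RootedAtDepth T (h ∸ j)) 𝒯j
  × AllPairs (λ S S' → ¬ (S ≅ S')) 𝒯j
  × (∀ (S : OTree j) → RootedAtDepth T (h ∸ j) S → Any (S ≅_) 𝒯j)

IsCover : ∀ {j} → List (OTree j) → List (List (OTree j)) → Set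
IsCover 𝒯j 𝒞j =
    All (λ c → All (_∈ 𝒯j) c × Linked _⊏_ c) 𝒞j
  × All (λ S → Any (S ∈_) 𝒞j) 𝒯j

-- Labels: L̄(S) = L(S) ∪ {⊤}, with ⊤ = nothing.

Label : Set
Label = Maybe (List ℕ)

⊤L : Label
⊤L = nothing

data _<L_ : Label → Label → Set where
  just< : ∀ {x y} → x <ₗ y → just x <L just y
  just<⊤ : ∀ {x} → just x <L nothing

_≤L_ : Label → Label → Set
a ≤L b = a ≡ b ⊎ a <L b

InLbar : ∀ {j} → OTree j → Label → Set
InLbar S a = a ≡ nothing ⊎ ∃[ x ] a ≡ just x × x ∈ leaves S

-- ξ|_p for a leaf ξ = (ξ_{2j-1},…,ξ_1) of a height-j tree: keep the
-- components of index ≥ p, i.e. the first j ∸ ⌊p/2⌋ ones;  ⊤|_p = ⊤.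
half : ℕ → ℕ
half zero = zero
half (suc zero) = zero
half (suc (suc n)) = suc (half n)

trunc : ℕ → ℕ → Label → Label
trunc j p nothing  = nothing
trunc j p (just x) = just (take (j ∸ half p) x)

module _ {j : ℕ} (S : OTree j) where

  -- arc vw with π(v) = p, ν(v) = a, ν(w) = b
  NonViolated : ℕ → Label → Label → Set
  NonViolated p a b =
      (Even p × trunc j p b ≤L trunc j p a)
    ⊎ (Odd p × (trunc j p b <L trunc j p a ⊎ (a ≡ nothing × b ≡ nothing)))

  Violated : ℕ → Label → Label → Set
  Violated p a b = ¬ NonViolated p a b

  Tight : ℕ → Label → Label → Set
  Tight p a b = InLbar S a × NonViolated p a b
              × (∀ s → InLbar S s → NonViolated p s b → a ≤L s)

  Loose : ℕ → Label → Label → Set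
  Loose p a b = ¬ Violated p a b × ¬ Tight p a b

  IsMinLeaf : List ℕ → Set
  IsMinLeaf m = m ∈ leaves S × All (m ≤ₗ_) (leaves S)

  module _ (G : Game) (τ : Fin (Game.N G) → Fin (Game.N G)) (w : Fin (Game.N G)) where
    open Game G

    -- λ into L̄(S) on V(J_w), λ ≤ ν₀ pointwise (ν₀(w) = min L(S), ν₀ = ⊤
    -- elsewhere), and no arc of J_w is loose w.r.t. λ
    Admissible : (Fin N → Label) → Set
    Admissible lam =
        (∀ u → InJ G τ w u → InLbar S (lam u))
      × (∀ m → IsMinLeaf m → lam w ≤L just m)
      × (∀ u x → JArc G τ w u x → ¬ Loose (π u) (lam u) (lam x))

    IsLambda : (Fin N → Label) → Set
    IsLambda lam = Admissible lam
      × (∀ lam' → Admissible lam' → ∀ u → InJ G τ w u → lam' u ≤L lam u)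

-- An embedding f : S ⊑ S' of ordered trees of equal height extends to a map
-- F : L̄(S) → L̄(S') with F ⊤ = ⊤ that is strictly monotone on nodes and commutes with
-- the truncations ·|_p, so it preserves non-violation of arcs. Its lower adjoint
-- g = pullback, g ℓ = min {s ∈ L̄(S) | ℓ ≤ F s}, pulls every admissible labeling λ'
-- into L̄(S') back to an admissible labeling g ∘ λ' into L̄(S): an arc made loose by
-- g ∘ λ' would already be loose for λ'. Since the chain 𝒞ᵏⱼ is ⊑-increasing,
-- maximality of λ_i gives g ∘ λ_{i'} ≤ λ_i, and g ⊤ = ⊤.

module Submission where

open import Defs
open import Data.Nat using (ℕ; zero; suc; _≤_; _/_; _∸_; _+_; z≤n; s≤s)
open import Data.Nat.Properties using (<-irrefl; <-trans; <-cmp; +-cancelʳ-≡; m≤n⇒m⊓n≡m; m∸n≤m)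
open import Data.Nat.DivMod using (/-monoˡ-≤)
open import Data.Fin using (Fin; toℕ; zero; suc)
open import Data.List using (List; []; _∷_; _++_; [_]; length; lookup; take; drop; map; filter)
open import Data.List.Properties using (++-assoc; ++-identityʳ; take++drop≡id; length-take; length-++)
open import Data.List.Membership.Propositional using (_∈_)
open import Data.List.Membership.Propositional.Properties
  using (∈-map⁺; ∈-map⁻; ∈-filter⁺; ∈-filter⁻; ∈-lookup)
open import Data.List.Relation.Unary.Any using (here; there)
open import Data.List.Relation.Unary.All as All using (All; _∷_)
open import Data.List.Relation.Unary.Linked as Linked using (Linked; _∷_)
import Data.List.Extrema
open import Data.Maybe as Maybe using (just; nothing)
open import Data.Product using (∃; ∃-syntax; _×_; _,_; proj₁; proj₂)
open import Data.Sum using (_⊎_; inj₁; inj₂; [_,_]′)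
open import Data.Unit using (⊤; tt)
open import Data.Empty using (⊥-elim)
open import Function using (_∘_; id)
open import Level using (0ℓ)
open import Relation.Nullary using (¬_; yes; no)
open import Relation.Binary
  using (Rel; Reflexive; Transitive; Connex; Decidable; IsTotalOrder; TotalOrder; tri<; tri≈; tri>)
open import Relation.Binary.PropositionalEquality
  using (_≡_; _≢_; refl; sym; trans; cong; subst; subst₂; isEquivalence; module ≡-Reasoning)

module ReflexiveClosure {A : Set} (_≺_ : Rel A 0ℓ)
  (≺-irrefl : ∀ {x} → ¬ x ≺ x) (≺-trans : Transitive _≺_)
  (≺-cmp : ∀ x y → x ≺ y ⊎ x ≡ y ⊎ y ≺ x) where

  _≼_ : Rel A 0ℓ
  x ≼ y = x ≡ y ⊎ x ≺ y

  ≼-trans : Transitive _≼_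
  ≼-trans (inj₁ refl) y≼z = y≼z
  ≼-trans (inj₂ x≺y) (inj₁ refl) = inj₂ x≺y
  ≼-trans (inj₂ x≺y) (inj₂ y≺z) = inj₂ (≺-trans x≺y y≺z)

  ≼-≺-trans : ∀ {x y z} → x ≼ y → y ≺ z → x ≺ z
  ≼-≺-trans (inj₁ refl) y≺z = y≺z
  ≼-≺-trans (inj₂ x≺y) y≺z = ≺-trans x≺y y≺z

  ≺-≼-trans : ∀ {x y z} → x ≺ y → y ≼ z → x ≺ z
  ≺-≼-trans x≺y (inj₁ refl) = x≺y
  ≺-≼-trans x≺y (inj₂ y≺z) = ≺-trans x≺y y≺z

  ≺⇒⋡ : ∀ {x y} → x ≺ y → ¬ y ≼ x
  ≺⇒⋡ x≺y y≼x = ≺-irrefl (≺-≼-trans x≺y y≼x)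

  ≼-≺-connex : Connex _≼_ _≺_
  ≼-≺-connex x y with ≺-cmp x y
  ... | inj₁ x≺y = inj₁ (inj₂ x≺y)
  ... | inj₂ (inj₁ x≡y) = inj₁ (inj₁ x≡y)
  ... | inj₂ (inj₂ y≺x) = inj₂ y≺x

  _≼?_ : Decidable _≼_
  x ≼? y with ≼-≺-connex x y
  ... | inj₁ x≼y = yes x≼y
  ... | inj₂ y≺x = no (≺⇒⋡ y≺x)

  ≼-isTotalOrder : IsTotalOrder _≡_ _≼_
  ≼-isTotalOrder = record
    { isPartialOrder = record
      { isPreorder = record { isEquivalence = isEquivalence ; reflexive = inj₁ ; trans = ≼-trans }
      ; antisym = antisym }
    ; total = total }
    where
    antisym : ∀ {x y} → x ≼ y → y ≼ x → x ≡ y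
    antisym (inj₁ x≡y) _ = x≡y
    antisym (inj₂ x≺y) y≼x = ⊥-elim (≺⇒⋡ x≺y y≼x)
    total : ∀ x y → x ≼ y ⊎ y ≼ x
    total x y = [ inj₁ , inj₂ ∘ inj₂ ]′ (≼-≺-connex x y)

  ≼-totalOrder : TotalOrder 0ℓ 0ℓ 0ℓ
  ≼-totalOrder = record { isTotalOrder = ≼-isTotalOrder }

<ₗ-irrefl : ∀ {x} → ¬ x <ₗ x
<ₗ-irrefl (head< a<a) = <-irrefl refl a<a
<ₗ-irrefl (tail< x<x) = <ₗ-irrefl x<x

<ₗ-trans : Transitive _<ₗ_
<ₗ-trans []<∷ (head< _) = []<∷
<ₗ-trans []<∷ (tail< _) = []<∷
<ₗ-trans (head< a<b) (head< b<c) = head< (<-trans a<b b<c)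
<ₗ-trans (head< a<b) (tail< _) = head< a<b
<ₗ-trans (tail< _) (head< b<c) = head< b<c
<ₗ-trans (tail< x<y) (tail< y<z) = tail< (<ₗ-trans x<y y<z)

<ₗ-cmp : ∀ x y → x <ₗ y ⊎ x ≡ y ⊎ y <ₗ x
<ₗ-cmp [] [] = inj₂ (inj₁ refl)
<ₗ-cmp [] (_ ∷ _) = inj₁ []<∷
<ₗ-cmp (_ ∷ _) [] = inj₂ (inj₂ []<∷)
<ₗ-cmp (a ∷ x) (b ∷ y) with <-cmp a b
... | tri< a<b _ _ = inj₁ (head< a<b)
... | tri> _ _ b<a = inj₂ (inj₂ (head< b<a))
... | tri≈ _ refl _ with <ₗ-cmp x y
...   | inj₁ x<y = inj₁ (tail< x<y)
...   | inj₂ (inj₁ refl) = inj₂ (inj₁ refl)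
...   | inj₂ (inj₂ y<x) = inj₂ (inj₂ (tail< y<x))

<L-irrefl : ∀ {a} → ¬ a <L a
<L-irrefl (just< x<x) = <ₗ-irrefl x<x

<L-trans : Transitive _<L_
<L-trans (just< x<y) (just< y<z) = just< (<ₗ-trans x<y y<z)
<L-trans (just< _) just<⊤ = just<⊤

<L-cmp : ∀ a b → a <L b ⊎ a ≡ b ⊎ b <L a
<L-cmp nothing nothing = inj₂ (inj₁ refl)
<L-cmp nothing (just _) = inj₂ (inj₂ just<⊤)
<L-cmp (just _) nothing = inj₁ just<⊤
<L-cmp (just x) (just y) with <ₗ-cmp x y
... | inj₁ x<y = inj₁ (just< x<y)
... | inj₂ (inj₁ refl) = inj₂ (inj₁ refl)
... | inj₂ (inj₂ y<x) = inj₂ (inj₂ (just< y<x))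

module LexOrder = ReflexiveClosure _<ₗ_ <ₗ-irrefl <ₗ-trans <ₗ-cmp
module LabelOrder = ReflexiveClosure _<L_ <L-irrefl <L-trans <L-cmp
open LabelOrder using () renaming
  ( _≼?_ to _≤L?_; ≺⇒⋡ to <L⇒≰L; ≼-≺-connex to ≤L-<L-connex
  ; ≼-trans to ≤L-trans; ≼-≺-trans to ≤L-<L-trans; ≺-≼-trans to <L-≤L-trans )

≤L-⊤ : ∀ a → a ≤L ⊤L
≤L-⊤ nothing = inj₁ refl
≤L-⊤ (just _) = inj₂ just<⊤

⊤-≤L : ∀ {a} → ⊤L ≤L a → a ≡ ⊤L
⊤-≤L (inj₁ refl) = refl

take-mono : ∀ k {x y} → x <ₗ y → take k x ≤ₗ take k y
take-mono zero _ = inj₁ refl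
take-mono (suc k) []<∷ = inj₂ []<∷
take-mono (suc k) (head< a<b) = inj₂ (head< a<b)
take-mono (suc k) (tail< {a} x<y) with take-mono k x<y
... | inj₁ eq = inj₁ (cong (a ∷_) eq)
... | inj₂ lt = inj₂ (tail< lt)

trunc-mono : ∀ j p {a b} → a ≤L b → trunc j p a ≤L trunc j p b
trunc-mono j p (inj₁ refl) = inj₁ refl
trunc-mono j p (inj₂ just<⊤) = inj₂ just<⊤
trunc-mono j p (inj₂ (just< x<y)) with take-mono (j ∸ half p) x<y
... | inj₁ eq = inj₁ (cong just eq)
... | inj₂ lt = inj₂ (just< lt)

just-≤L : ∀ {x y} → x ≤ₗ y → just x ≤L just y
just-≤L (inj₁ refl) = inj₁ refl
just-≤L (inj₂ x<y) = inj₂ (just< x<y)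

length≡0⇒≡[] : ∀ {A : Set} {xs : List A} → length xs ≡ 0 → xs ≡ []
length≡0⇒≡[] {xs = []} _ = refl

take-length-++ : ∀ {A : Set} (xs ys : List A) → take (length xs) (xs ++ ys) ≡ xs
take-length-++ [] ys = refl
take-length-++ (x ∷ xs) ys = cong (x ∷_) (take-length-++ xs ys)

Linked-lookup-mono : ∀ {A : Set} {R : Rel A 0ℓ} → Reflexive R → Transitive R →
  ∀ {xs} → Linked R xs →
  (i i' : Fin (length xs)) → toℕ i ≤ toℕ i' → R (lookup xs i) (lookup xs i')
Linked-lookup-mono R-refl R-trans {_ ∷ _} _ zero zero _ = R-refl
Linked-lookup-mono R-refl R-trans (r ∷ rs) zero (suc i') _ =
  R-trans r (Linked-lookup-mono R-refl R-trans rs zero i' z≤n)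
Linked-lookup-mono R-refl R-trans (_ ∷ rs) (suc i) (suc i') (s≤s i≤i') =
  Linked-lookup-mono R-refl R-trans rs i i' i≤i'

module _ {h : ℕ} (T : OTree h) where

  leaf-node : ∀ {x} → x ∈ leaves T → Node T x
  leaf-node {x} x∈T = [] , subst (_∈ leaves T) (sym (++-identityʳ x)) x∈T

  prefix-node : ∀ x z → Node T (x ++ z) → Node T x
  prefix-node x z (z' , xzz'∈T) = z ++ z' , subst (_∈ leaves T) (++-assoc x z z') xzz'∈T

  take-node : ∀ k {x} → x ∈ leaves T → Node T (take k x)
  take-node k {x} x∈T = drop k x , subst (_∈ leaves T) (sym (take++drop≡id k x)) x∈T

  least-leaf : ∃ (IsMinLeaf T)
  least-leaf with leaves T | nonempty T
  ... | [] | []≢[] = ⊥-elim ([]≢[] refl)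
  ... | x ∷ xs | _ = min x xs , [ here , there ]′ (argmin-sel id x xs) , min≤⊤ x xs ∷ min≤xs x xs
    where open Data.List.Extrema LexOrder.≼-totalOrder

  IsNodeLabel : Label → Set
  IsNodeLabel nothing = ⊤
  IsNodeLabel (just x) = Node T x

  trunc-IsNodeLabel : ∀ p {a} → InLbar T a → IsNodeLabel (trunc h p a)
  trunc-IsNodeLabel p (inj₁ refl) = tt
  trunc-IsNodeLabel p (inj₂ (x , refl , x∈T)) = take-node (h ∸ half p) x∈T

⊑-refl : ∀ {h} → Reflexive (_⊑_ {h} {h})
⊑-refl = id , (λ _ n → n) , (λ _ _ _ _ e → e) , (λ _ a _ → a , refl)
  , (λ _ _ _ _ x<y → x<y) , (λ _ x∈T → x∈T)

⊑-trans : ∀ {h} → Transitive (_⊑_ {h} {h})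
⊑-trans {i = T₁} {j = T₂}
  (f , node , inj , child , mono , leaf) (f' , node' , inj' , child' , mono' , leaf') =
    f' ∘ f
  , (λ x nx → node' (f x) (node x nx))
  , (λ x y nx ny e → inj x y nx ny (inj' (f x) (f y) (node x nx) (node y ny) e))
  , child″
  , (λ x y nx ny x<y → mono' (f x) (f y) (node x nx) (node y ny) (mono x y nx ny x<y))
  , (λ x x∈T → leaf' (f x) (leaf x x∈T))
  where
  child″ : ∀ x a → Node T₁ (x ++ [ a ]) → ∃[ c ] f' (f (x ++ [ a ])) ≡ f' (f x) ++ [ c ]
  child″ x a nxa with child x a nxa
  ... | b , fxa≡fx++b with child' (f x) b (subst (Node T₂) fxa≡fx++b (node (x ++ [ a ]) nxa))
  ...   | c , e = c , trans (cong f' fxa≡fx++b) e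

module Embedding {j : ℕ} {S S' : OTree j} (S⊑S' : S ⊑ S') where
  open ≡-Reasoning

  f : List ℕ → List ℕ
  f = proj₁ S⊑S'

  f-child : ∀ x a → Node S (x ++ [ a ]) → ∃[ b ] f (x ++ [ a ]) ≡ f x ++ [ b ]
  f-child = proj₁ (proj₂ (proj₂ (proj₂ S⊑S')))

  f-< : ∀ x y → Node S x → Node S y → x <ₗ y → f x <ₗ f y
  f-< = proj₁ (proj₂ (proj₂ (proj₂ (proj₂ S⊑S'))))

  f-leaf : ∀ x → x ∈ leaves S → f x ∈ leaves S'
  f-leaf = proj₂ (proj₂ (proj₂ (proj₂ (proj₂ S⊑S'))))

  f-++ : ∀ y z → Node S (y ++ z) → ∃[ z' ] f (y ++ z) ≡ f y ++ z' × length z' ≡ length z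
  f-++ y [] _ = [] , trans (cong f (++-identityʳ y)) (sym (++-identityʳ (f y))) , refl
  f-++ y (a ∷ z) nyaz with subst (Node S) (sym (++-assoc y [ a ] z)) nyaz
  ... | nya++z with f-++ (y ++ [ a ]) z nya++z | f-child y a (prefix-node S (y ++ [ a ]) z nya++z)
  ...   | z' , fyaz≡fya++z' , |z'|≡|z| | b , fya≡fy++b = b ∷ z' , fyaz≡fy++bz' , cong suc |z'|≡|z|
    where
    fyaz≡fy++bz' : f (y ++ a ∷ z) ≡ f y ++ b ∷ z'
    fyaz≡fy++bz' = begin
      f (y ++ a ∷ z)        ≡⟨ cong f (sym (++-assoc y [ a ] z)) ⟩
      f ((y ++ [ a ]) ++ z) ≡⟨ fyaz≡fya++z' ⟩
      f (y ++ [ a ]) ++ z'  ≡⟨ cong (_++ z') fya≡fy++b ⟩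
      (f y ++ [ b ]) ++ z'  ≡⟨ ++-assoc (f y) [ b ] z' ⟩
      f y ++ b ∷ z'         ∎

  f-root : f [] ≡ []
  f-root with least-leaf S
  ... | x , x∈S , _ with f-++ [] x (leaf-node S x∈S)
  ...   | z , fx≡f[]++z , |z|≡|x| =
    length≡0⇒≡[] (+-cancelʳ-≡ (length x) (length (f [])) 0 |f[]|+|x|≡|x|)
    where
    |f[]|+|x|≡|x| : length (f []) + length x ≡ length x
    |f[]|+|x|≡|x| = begin
      length (f []) + length x ≡⟨ cong (length (f []) +_) (sym |z|≡|x|) ⟩
      length (f []) + length z ≡⟨ sym (length-++ (f [])) ⟩
      length (f [] ++ z)       ≡⟨ cong length (sym fx≡f[]++z) ⟩
      length (f x)             ≡⟨ All.lookup (depth S') (f-leaf x x∈S) ⟩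
      j                        ≡⟨ sym (All.lookup (depth S) x∈S) ⟩
      length x                 ∎

  f-length : ∀ {x} → Node S x → length (f x) ≡ length x
  f-length {x} nx with f-++ [] x nx
  ... | z , fx≡f[]++z , |z|≡|x| = trans (cong length (trans fx≡f[]++z (cong (_++ z) f-root))) |z|≡|x|

  f-take : ∀ k {x} → k ≤ j → x ∈ leaves S → take k (f x) ≡ f (take k x)
  f-take k {x} k≤j x∈S
    with f-++ (take k x) (drop k x) (subst (Node S) (sym (take++drop≡id k x)) (leaf-node S x∈S))
  ... | z , e , _ = begin
    take k (f x)                                       ≡⟨ cong (take k ∘ f) (sym (take++drop≡id k x)) ⟩
    take k (f (take k x ++ drop k x))                  ≡⟨ cong (take k) e ⟩
    take k (f (take k x) ++ z)                         ≡⟨ cong (λ n → take n (f (take k x) ++ z)) (sym |f[take]|≡k) ⟩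
    take (length (f (take k x))) (f (take k x) ++ z)   ≡⟨ take-length-++ (f (take k x)) z ⟩
    f (take k x)                                       ∎
    where
    |f[take]|≡k : length (f (take k x)) ≡ k
    |f[take]|≡k = trans (f-length (take-node S k x∈S))
      (trans (length-take k x) (m≤n⇒m⊓n≡m (subst (k ≤_) (sym (All.lookup (depth S) x∈S)) k≤j)))

  F : Label → Label
  F = Maybe.map f

  F-InLbar : ∀ {a} → InLbar S a → InLbar S' (F a)
  F-InLbar (inj₁ refl) = inj₁ refl
  F-InLbar (inj₂ (x , refl , x∈S)) = inj₂ (f x , refl , f-leaf x x∈S)

  F-trunc : ∀ p {a} → InLbar S a → trunc j p (F a) ≡ F (trunc j p a)
  F-trunc p (inj₁ refl) = refl
  F-trunc p (inj₂ (x , refl , x∈S)) = cong just (f-take (j ∸ half p) (m∸n≤m j (half p)) x∈S)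

  F-mono-< : ∀ {a b} → IsNodeLabel S a → IsNodeLabel S b → a <L b → F a <L F b
  F-mono-< {just x} {just y} nx ny (just< x<y) = just< (f-< x y nx ny x<y)
  F-mono-< _ _ just<⊤ = just<⊤

  F-mono-≤ : ∀ {a b} → IsNodeLabel S a → IsNodeLabel S b → a ≤L b → F a ≤L F b
  F-mono-≤ _ _ (inj₁ refl) = inj₁ refl
  F-mono-≤ na nb (inj₂ a<b) = inj₂ (F-mono-< na nb a<b)

  NonViolated-map : ∀ p {a b} → InLbar S a → InLbar S b →
    NonViolated S p a b → NonViolated S' p (F a) (F b)
  NonViolated-map p a∈S b∈S (inj₁ (even , b≤a)) = inj₁ (even ,
    subst₂ _≤L_ (sym (F-trunc p b∈S)) (sym (F-trunc p a∈S))
      (F-mono-≤ (trunc-IsNodeLabel S p b∈S) (trunc-IsNodeLabel S p a∈S) b≤a))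
  NonViolated-map p a∈S b∈S (inj₂ (odd , inj₁ b<a)) = inj₂ (odd , inj₁
    (subst₂ _<L_ (sym (F-trunc p b∈S)) (sym (F-trunc p a∈S))
      (F-mono-< (trunc-IsNodeLabel S p b∈S) (trunc-IsNodeLabel S p a∈S) b<a)))
  NonViolated-map p _ _ (inj₂ (odd , inj₂ (refl , refl))) = inj₂ (odd , inj₂ (refl , refl))

  open Data.List.Extrema LabelOrder.≼-totalOrder using (min; argmin-sel; min≤⊤; min≤xs)

  candidates : Label → List Label
  candidates ℓ = filter (λ s → ℓ ≤L? F s) (map just (leaves S))

  pullback : Label → Label
  pullback ℓ = min ⊤L (candidates ℓ)

  pullback-sel : ∀ ℓ → pullback ℓ ≡ ⊤L ⊎ ∃[ x ] pullback ℓ ≡ just x × x ∈ leaves S × ℓ ≤L just (f x)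
  pullback-sel ℓ with argmin-sel id ⊤L (candidates ℓ)
  ... | inj₁ g≡⊤ = inj₁ g≡⊤
  ... | inj₂ g∈ with ∈-filter⁻ (λ s → ℓ ≤L? F s) g∈
  ...   | g∈leaves , ℓ≤Fg with ∈-map⁻ just g∈leaves
  ...     | x , x∈S , g≡x = inj₂ (x , g≡x , x∈S , subst (λ s → ℓ ≤L F s) g≡x ℓ≤Fg)

  pullback-InLbar : ∀ ℓ → InLbar S (pullback ℓ)
  pullback-InLbar ℓ with pullback-sel ℓ
  ... | inj₁ g≡⊤ = inj₁ g≡⊤
  ... | inj₂ (x , g≡x , x∈S , _) = inj₂ (x , g≡x , x∈S)

  pullback-≥ : ∀ ℓ → ℓ ≤L F (pullback ℓ)
  pullback-≥ ℓ with pullback-sel ℓ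
  ... | inj₁ g≡⊤ = subst (λ s → ℓ ≤L F s) (sym g≡⊤) (≤L-⊤ ℓ)
  ... | inj₂ (x , g≡x , _ , ℓ≤Fx) = subst (λ s → ℓ ≤L F s) (sym g≡x) ℓ≤Fx

  pullback-least : ∀ {ℓ s} → InLbar S s → ℓ ≤L F s → pullback ℓ ≤L s
  pullback-least {ℓ} (inj₁ refl) _ = min≤⊤ ⊤L (candidates ℓ)
  pullback-least {ℓ} (inj₂ (x , refl , x∈S)) ℓ≤Fx =
    All.lookup (min≤xs ⊤L (candidates ℓ)) (∈-filter⁺ (λ s → ℓ ≤L? F s) (∈-map⁺ just x∈S) ℓ≤Fx)

  pullback-⊤ : pullback ⊤L ≡ ⊤L
  pullback-⊤ with pullback-sel ⊤L
  ... | inj₁ g≡⊤ = g≡⊤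
  ... | inj₂ (_ , _ , _ , inj₂ ())

module _ {j : ℕ} (S : OTree j) where

  NonViolated-monoˡ : ∀ p {a a' b} → a ≤L a' → NonViolated S p a b → NonViolated S p a' b
  NonViolated-monoˡ p a≤a' (inj₁ (even , b≤a)) = inj₁ (even , ≤L-trans b≤a (trunc-mono j p a≤a'))
  NonViolated-monoˡ p {a' = just _} a≤a' (inj₂ (odd , inj₁ b<a)) =
    inj₂ (odd , inj₁ (<L-≤L-trans b<a (trunc-mono j p a≤a')))
  NonViolated-monoˡ p {a' = just _} (inj₂ ()) (inj₂ (odd , inj₂ (refl , refl)))
  NonViolated-monoˡ p {a' = nothing} {nothing} _ (inj₂ (odd , _)) = inj₂ (odd , inj₂ (refl , refl))
  NonViolated-monoˡ p {a' = nothing} {just _} _ (inj₂ (odd , _)) = inj₂ (odd , inj₁ just<⊤)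

  NonViolated-antitoneʳ : ∀ p {a b b'} → b' ≤L b → NonViolated S p a b → NonViolated S p a b'
  NonViolated-antitoneʳ p b'≤b (inj₁ (even , b≤a)) = inj₁ (even , ≤L-trans (trunc-mono j p b'≤b) b≤a)
  NonViolated-antitoneʳ p b'≤b (inj₂ (odd , inj₁ b<a)) =
    inj₂ (odd , inj₁ (≤L-<L-trans (trunc-mono j p b'≤b) b<a))
  NonViolated-antitoneʳ p {b' = nothing} _ (inj₂ (odd , inj₂ (refl , refl))) = inj₂ (odd , inj₂ (refl , refl))
  NonViolated-antitoneʳ p {b' = just _} _ (inj₂ (odd , inj₂ (refl , refl))) = inj₂ (odd , inj₁ just<⊤)

  -- If some s ∈ L̄(S) below a already satisfied the arc, the arc would be loose at a.
  ¬Loose⇒≤ : ∀ p {a b s} → InLbar S s → NonViolated S p s b → ¬ Loose S p a b → a ≤L s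
  ¬Loose⇒≤ p {a} {s = s} s∈S s-ok ¬loose with ≤L-<L-connex a s
  ... | inj₁ a≤s = a≤s
  ... | inj₂ s<a = ⊥-elim (¬loose
    ( (λ violated → violated (NonViolated-monoˡ p (inj₂ s<a) s-ok))
    , (λ (_ , _ , least) → <L⇒≰L s<a (least s s∈S s-ok))))

module _ {j : ℕ} {S S' : OTree j} (S⊑S' : S ⊑ S')
  (G : Game) (τ : Fin (Game.N G) → Fin (Game.N G)) (w : Fin (Game.N G)) where
  open Game G
  open Embedding {S = S} {S'} S⊑S'

  pullback-Admissible : ∀ {lam'} → Admissible S' G τ w lam' → Admissible S G τ w (pullback ∘ lam')
  pullback-Admissible {lam'} (_ , lam'-w , lam'-not-loose) =
    (λ u _ → pullback-InLbar (lam' u)) , w-bound , not-loose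
    where
    w-bound : ∀ m → IsMinLeaf S m → pullback (lam' w) ≤L just m
    w-bound m (m∈S , _) with least-leaf S'
    ... | m' , m'-least = pullback-least (inj₂ (m , refl , m∈S))
      (≤L-trans (lam'-w m' m'-least) (just-≤L (All.lookup (proj₂ m'-least) (f-leaf m m∈S))))

    not-loose : ∀ v x → JArc G τ w v x → ¬ Loose S (π v) (pullback (lam' v)) (pullback (lam' x))
    not-loose v x vx (¬violated , ¬tight) =
      ¬violated λ v-ok → ¬tight (pullback-InLbar (lam' v) , v-ok , least)
      where
      least : ∀ s → InLbar S s → NonViolated S (π v) s (pullback (lam' x)) → pullback (lam' v) ≤L s
      least s s∈S s-ok = pullback-least s∈S
        (¬Loose⇒≤ S' (π v) (F-InLbar s∈S) Fs-ok (lam'-not-loose v x vx))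
        where
        Fs-ok : NonViolated S' (π v) (F s) (lam' x)
        Fs-ok = NonViolated-antitoneʳ S' (π v) (pullback-≥ (lam' x))
          (NonViolated-map (π v) s∈S (pullback-InLbar (lam' x)) s-ok)

IsLambda-≢⊤-mono : ∀ {j} {S S' : OTree j} → S ⊑ S' → (G : Game) → let open Game G in
  (τ : Fin N → Fin N) (w : Fin N) {lam lam' : Fin N → Label} →
  IsLambda S G τ w lam → IsLambda S' G τ w lam' →
  ∀ {u} → InJ G τ w u → lam u ≢ ⊤L → lam' u ≢ ⊤L
IsLambda-≢⊤-mono {S = S} {S'} S⊑S' G τ w {lam} {lam'} (_ , lam-greatest) (lam'-admissible , _)
  {u} u∈J lam-u≢⊤ lam'-u≡⊤ =
  lam-u≢⊤ (⊤-≤L (subst (_≤L lam u) pullback-lam'-u≡⊤ pullback-lam'-u≤lam-u))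
  where
  open Embedding {S = S} {S'} S⊑S'
  pullback-lam'-u≤lam-u : pullback (lam' u) ≤L lam u
  pullback-lam'-u≤lam-u =
    lam-greatest (pullback ∘ lam') (pullback-Admissible {S = S} {S'} S⊑S' G τ w lam'-admissible) u u∈J
  pullback-lam'-u≡⊤ : pullback (lam' u) ≡ ⊤L
  pullback-lam'-u≡⊤ = trans (cong pullback lam'-u≡⊤) pullback-⊤

lemma4p10 : (G : Game) → let open Game G in
    (τ : Fin N → Fin N) → IsOddStrategy G τ →
    (T : OTree (d / 2)) → Universal N (d / 2) T →
    (𝒯 : (j : ℕ) → List (OTree j)) → (∀ j → j ≤ d / 2 → Reps T j (𝒯 j)) →
    (𝒞 : (j : ℕ) → List (List (OTree j))) → (∀ j → j ≤ d / 2 → IsCover (𝒯 j) (𝒞 j)) →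
    (w : Fin N) → IsBase G τ w →
    (k : Fin (length (𝒞 (π w / 2)))) →
    (u : Fin N) → InJ G τ w u →
    (i i' : Fin (length (lookup (𝒞 (π w / 2)) k))) → toℕ i ≤ toℕ i' →
    (lam lam' : Fin N → Label) →
    IsLambda (lookup (lookup (𝒞 (π w / 2)) k) i) G τ w lam →
    IsLambda (lookup (lookup (𝒞 (π w / 2)) k) i') G τ w lam' →
    lam u ≢ nothing → lam' u ≢ nothing
lemma4p10 G τ _ _ _ _ _ 𝒞 𝒞-covers w _ k u u∈J i i' i≤i' _ _ lam-greatest lam'-greatest =
  IsLambda-≢⊤-mono {S = Tᵢ} {Tᵢ'} Tᵢ⊑Tᵢ' G τ w lam-greatest lam'-greatest u∈J
  where
  open Game G
  j : ℕ
  j = π w / 2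
  chain : Linked _⊏_ (lookup (𝒞 j) k)
  chain = proj₂ (All.lookup (proj₁ (𝒞-covers j (/-monoˡ-≤ 2 (proj₂ (π-range w))))) (∈-lookup k))
  Tᵢ Tᵢ' : OTree j
  Tᵢ = lookup (lookup (𝒞 j) k) i
  Tᵢ' = lookup (lookup (𝒞 j) k) i'
  -- _⊑_ unfolds to a Σ-type, so its tree arguments must be supplied explicitly.
  Tᵢ⊑Tᵢ' : Tᵢ ⊑ Tᵢ'
  Tᵢ⊑Tᵢ' = Linked-lookup-mono (λ {T} → ⊑-refl {x = T}) (λ {T₁ T₂ T₃} → ⊑-trans {i = T₁} {T₂} {T₃})
    (Linked.map proj₁ chain) i i' i≤i'
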